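{- Let $G$ be a graph and let $u,v\in V(G)$ be distinct. If there exist positive integers $i$ and $d$ such that the number of copies (counted with multiplicity) of vertices of degree $d$ in the multiset $\mathcal L^i_G(u,v)$ differs from the corresponding number in $\mathcal L^i_G(v,u)$, then $\mathcal R^*\sigma(u)\neq\mathcal R^*\sigma(v)$.
   Context: Multisets $\mathcal L^i_G(u,v)$ are defined recursively: $\mathcal L^0_G(u,v)=\{u\}$; for $i\ge1$ and $w\in V(G)$ let $\ell^i_G(w,u,v)$ be the number of neighbours of $w$ in $\mathcal L^{i-1}_G(u,v)$ (counted with multiplicity), and let $\mathcal L^i_G(u,v)$ contain $w$ with multiplicity $\ell^i_G(w,u,v)-\ell^i_G(w,v,u)$ if this is positive, and $0$ times otherwise. Colour refinement: $\mathcal R_Gc(v)=(c(v),(d_\omega(v))_\omega)$, $d_\omega(v)$ the number of neighbours of $v$ of colour $\omega$; iterating until the vertex partition stabilises gives $\mathcal R^*c$; $\sigma$ is the trivial colouring giving all vertices the same colour. -}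

module Defs where

open import Data.Nat using (ℕ; zero; suc; _+_; _∸_; _≡ᵇ_; _<_)
open import Data.Bool using (Bool; true; false; if_then_else_; _∧_)
open import Data.Fin using (Fin; zero; suc; _≟_)
open import Relation.Nullary.Decidable using (⌊_⌋)
open import Relation.Binary.PropositionalEquality using (_≡_)

record Graph (n : ℕ) : Set where
  field
    adj   : Fin n → Fin n → Bool
    sym   : ∀ x y → adj x y ≡ adj y x
    irrefl : ∀ x → adj x x ≡ false
open Graph public

Σᵥ : ∀ {n} → (Fin n → ℕ) → ℕ
Σᵥ {zero}  f = 0
Σᵥ {suc n} f = f zero + Σᵥ {n} (λ x → f (suc x))

countᵥ : ∀ {n} → (Fin n → Bool) → ℕ
countᵥ p = Σᵥ (λ x → if p x then 1 else 0)

degree : ∀ {n} → Graph n → Fin n → ℕ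
degree G w = countᵥ (adj G w)

-- Multisets of vertices represented by their multiplicity functions.
-- L G i u v w = multiplicity of w in 𝓛^i_G(u,v).
-- ℓ^i_G(w,u,v) = Σ_{x ∼ w} mult. of x in 𝓛^{i-1}_G(u,v);
-- the multiplicity max(0, ℓ(w,u,v) - ℓ(w,v,u)) is truncated subtraction ∸.
L : ∀ {n} → Graph n → ℕ → Fin n → Fin n → Fin n → ℕ
ℓ : ∀ {n} → Graph n → ℕ → Fin n → Fin n → Fin n → ℕ
L G zero    u v w = if ⌊ w ≟ u ⌋ then 1 else 0
L G (suc i) u v w = ℓ G (suc i) w u v ∸ ℓ G (suc i) w v u
ℓ G zero    w u v = 0
ℓ G (suc i) w u v = Σᵥ (λ x → if adj G w x then L G i u v x else 0)

degCount : ∀ {n} → Graph n → ℕ → ℕ → Fin n → Fin n → ℕ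
degCount G i d u v = Σᵥ (λ w → if degree G w ≡ᵇ d then L G i u v w else 0)

-- Colour refinement from the trivial colouring σ.
-- sameColour G k x y = true  iff  (𝓡^k σ)(x) = (𝓡^k σ)(y).
-- 𝓡c(x) = 𝓡c(y) iff c(x) = c(y) and for every colour ω, d_ω(x) = d_ω(y);
-- colours ω occurring are exactly the classes of vertices z (others give 0 = 0).
sameColour : ∀ {n} → Graph n → ℕ → Fin n → Fin n → Bool
sameColour G zero    x y = true
sameColour G (suc k) x y =
  sameColour G k x y ∧
  allᵥ (λ z → countᵥ (λ w → adj G x w ∧ sameColour G k w z)
           ≡ᵇ countᵥ (λ w → adj G y w ∧ sameColour G k w z))
  where
  allᵥ : ∀ {m} → (Fin m → Bool) → Bool
  allᵥ {zero}  p = true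
  allᵥ {suc m} p = p zero ∧ allᵥ (λ x → p (suc x))

Stable : ∀ {n} → Graph n → ℕ → Set
Stable G k = ∀ x y → sameColour G (suc k) x y ≡ sameColour G k x y

-- k is the step at which iteration stops (first stabilisation), so 𝓡*σ = 𝓡^kσ.
StabilisesAt : ∀ {n} → Graph n → ℕ → Set
StabilisesAt G k = Stable G k × (∀ j → j < k → Stable G j → ⊥)
  where
  open import Data.Product using (_×_)
  open import Data.Empty using (⊥)

{-# OPTIONS --safe #-}
-- Write W_i(u, w) for the number of walks of length i from u to w.  By induction on i, the
-- multisets 𝓛^i(u,v) and 𝓛^i(v,u) are the positive and negative parts of W_i(u,·) − W_i(v,·),
-- so the two degree counts differ by Σ_{deg w = d} (W_i(u,w) − W_i(v,w)).  A stable colouring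
-- is equitable, so summing a colour-invariant function over the neighbours of a vertex gives
-- again a colour-invariant function.  The degree is such a sum, and Σ_w W_i(u,w) g(w) = (A^i g)(u)
-- for the adjacency operator A; hence vertices of the same stable colour have equal counts.
module Submission where

open import Defs
import Algebra.Properties.Semiring.Sum as SemiringSum
open import Data.Bool using (Bool; true; false; _∧_; if_then_else_)
open import Data.Bool.Properties using (∧-conicalˡ; ∧-conicalʳ; T-≡; if-cong; if-cong-then)
open import Data.Fin using (Fin; zero; suc; _≟_)
open import Data.Maybe as Maybe using (Maybe; just; nothing; fromMaybe)
open import Data.Nat using (ℕ; zero; suc; _+_; _*_; _∸_; _≡ᵇ_; _≤_)
open import Data.Nat.Properties using (+-*-semiring; suc-injective; +-comm; +-identityʳ; +-cancelʳ-≡; *-identityˡ; *-identityʳ; *-zeroʳ; ≡ᵇ⇒≡; ≡⇒≡ᵇ)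
open import Data.Product using (Σ; _×_; _,_; proj₂)
open import Function using (_∘_; Equivalence)
open import Relation.Binary using (IsEquivalence)
open import Relation.Nullary using (yes; no; contradiction)
open import Relation.Nullary.Decidable using (⌊_⌋; isYes≗does; dec-true)
open import Relation.Binary.PropositionalEquality as ≡ using (_≡_; _≢_; _≗_; refl; cong; cong₂; module ≡-Reasoning)

open SemiringSum +-*-semiring using (sum; sum-cong-≗; sum-replicate-zero; ∑-distrib-+; ∑-comm; *-distribˡ-sum; *-distribʳ-sum)
open ≡-Reasoning

Σᵥ≡sum : ∀ {n} (f : Fin n → ℕ) → Σᵥ f ≡ sum f
Σᵥ≡sum {zero}  f = refl
Σᵥ≡sum {suc n} f = cong (f zero +_) (Σᵥ≡sum (f ∘ suc))

Σᵥ-cong : ∀ {n} {f g : Fin n → ℕ} → f ≗ g → Σᵥ f ≡ Σᵥ g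
Σᵥ-cong {f = f} {g} f≗g = begin
  Σᵥ f   ≡⟨ Σᵥ≡sum f ⟩
  sum f  ≡⟨ sum-cong-≗ f≗g ⟩
  sum g  ≡⟨ Σᵥ≡sum g ⟨
  Σᵥ g   ∎

Σᵥ-zero : ∀ n → Σᵥ {n} (λ _ → 0) ≡ 0
Σᵥ-zero n = ≡.trans (Σᵥ≡sum {n} (λ _ → 0)) (sum-replicate-zero n)

Σᵥ-distrib-+ : ∀ {n} (f g : Fin n → ℕ) → Σᵥ (λ x → f x + g x) ≡ Σᵥ f + Σᵥ g
Σᵥ-distrib-+ f g = begin
  Σᵥ (λ x → f x + g x)  ≡⟨ Σᵥ≡sum (λ x → f x + g x) ⟩
  sum (λ x → f x + g x) ≡⟨ ∑-distrib-+ f g ⟩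
  sum f + sum g         ≡⟨ cong₂ _+_ (Σᵥ≡sum f) (Σᵥ≡sum g) ⟨
  Σᵥ f + Σᵥ g           ∎

Σᵥ-comm : ∀ {m n} (f : Fin m → Fin n → ℕ) → Σᵥ (λ x → Σᵥ (f x)) ≡ Σᵥ (λ y → Σᵥ (λ x → f x y))
Σᵥ-comm f = begin
  Σᵥ (λ x → Σᵥ (f x))             ≡⟨ Σᵥ²≡sum² f ⟩
  sum (λ x → sum (f x))           ≡⟨ ∑-comm f ⟩
  sum (λ y → sum (λ x → f x y))   ≡⟨ Σᵥ²≡sum² (λ y x → f x y) ⟨
  Σᵥ (λ y → Σᵥ (λ x → f x y))     ∎
  where
  Σᵥ²≡sum² : ∀ {m n} (h : Fin m → Fin n → ℕ) → Σᵥ (λ x → Σᵥ (h x)) ≡ sum (λ x → sum (h x))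
  Σᵥ²≡sum² h = ≡.trans (Σᵥ≡sum (λ x → Σᵥ (h x))) (sum-cong-≗ (λ x → Σᵥ≡sum (h x)))

*-distribˡ-Σᵥ : ∀ {n} c (f : Fin n → ℕ) → c * Σᵥ f ≡ Σᵥ (λ x → c * f x)
*-distribˡ-Σᵥ c f = begin
  c * Σᵥ f            ≡⟨ cong (c *_) (Σᵥ≡sum f) ⟩
  c * sum f           ≡⟨ *-distribˡ-sum c f ⟩
  sum (λ x → c * f x) ≡⟨ Σᵥ≡sum (λ x → c * f x) ⟨
  Σᵥ (λ x → c * f x)  ∎

*-distribʳ-Σᵥ : ∀ {n} c (f : Fin n → ℕ) → Σᵥ f * c ≡ Σᵥ (λ x → f x * c)
*-distribʳ-Σᵥ c f = begin
  Σᵥ f * c            ≡⟨ cong (_* c) (Σᵥ≡sum f) ⟩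
  sum f * c           ≡⟨ *-distribʳ-sum c f ⟩
  sum (λ x → f x * c) ≡⟨ Σᵥ≡sum (λ x → f x * c) ⟨
  Σᵥ (λ x → f x * c)  ∎

Σᵥ-if : ∀ {n} b (f : Fin n → ℕ) → Σᵥ (λ x → if b then f x else 0) ≡ (if b then Σᵥ f else 0)
Σᵥ-if     true  f = refl
Σᵥ-if {n} false f = Σᵥ-zero n

Σᵥ-δ : ∀ {n} (a : Fin n) (f : Fin n → ℕ) → Σᵥ (λ x → if ⌊ x ≟ a ⌋ then f x else 0) ≡ f a
Σᵥ-δ {suc n} zero    f = ≡.trans (cong (f zero +_) (Σᵥ-zero n)) (+-identityʳ (f zero))
Σᵥ-δ {suc n} (suc a) f = ≡.trans (Σᵥ-cong (λ x → if-cong (⌊suc≟suc⌋ x))) (Σᵥ-δ a (f ∘ suc))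
  where
  ⌊suc≟suc⌋ : ∀ x → ⌊ suc x ≟ suc a ⌋ ≡ ⌊ x ≟ a ⌋
  ⌊suc≟suc⌋ x with x ≟ a
  ... | yes _ = refl
  ... | no  _ = refl

Σᵥ⟨_⟩_ : ∀ {n} → (Fin n → Bool) → (Fin n → ℕ) → ℕ
Σᵥ⟨ c ⟩ f = Σᵥ (λ x → if c x then f x else 0)

*-if : ∀ b m c → m * (if b then c else 0) ≡ (if b then m * c else 0)
*-if true  m c = refl
*-if false m c = *-zeroʳ m

if-* : ∀ b m c → (if b then m else 0) * c ≡ (if b then m * c else 0)
if-* true  m c = refl
if-* false m c = refl

Σᵥ⟨⟩-distrib-+ : ∀ {n} (c : Fin n → Bool) (f g : Fin n → ℕ) →
                 Σᵥ⟨ c ⟩ (λ x → f x + g x) ≡ Σᵥ⟨ c ⟩ f + Σᵥ⟨ c ⟩ g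
Σᵥ⟨⟩-distrib-+ c f g =
  ≡.trans (Σᵥ-cong if-+) (Σᵥ-distrib-+ (λ x → if c x then f x else 0) (λ x → if c x then g x else 0))
  where
  if-+ : ∀ x → (if c x then f x + g x else 0) ≡ (if c x then f x else 0) + (if c x then g x else 0)
  if-+ x with c x
  ... | true  = refl
  ... | false = refl

Σᵥ⟨⟩-balance : ∀ {n} (c : Fin n → Bool) {f g f′ g′ : Fin n → ℕ} → (∀ x → f x + g x ≡ f′ x + g′ x) →
               Σᵥ⟨ c ⟩ f + Σᵥ⟨ c ⟩ g ≡ Σᵥ⟨ c ⟩ f′ + Σᵥ⟨ c ⟩ g′
Σᵥ⟨⟩-balance c {f} {g} {f′} {g′} balanced = begin
  Σᵥ⟨ c ⟩ f + Σᵥ⟨ c ⟩ g             ≡⟨ Σᵥ⟨⟩-distrib-+ c f g ⟨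
  Σᵥ⟨ c ⟩ (λ x → f x + g x)         ≡⟨ Σᵥ-cong (λ x → if-cong-then (c x) (balanced x)) ⟩
  Σᵥ⟨ c ⟩ (λ x → f′ x + g′ x)       ≡⟨ Σᵥ⟨⟩-distrib-+ c f′ g′ ⟩
  Σᵥ⟨ c ⟩ f′ + Σᵥ⟨ c ⟩ g′           ∎

*-distribˡ-Σᵥ⟨⟩ : ∀ {n} m (c : Fin n → Bool) (f : Fin n → ℕ) → m * Σᵥ⟨ c ⟩ f ≡ Σᵥ⟨ c ⟩ (λ x → m * f x)
*-distribˡ-Σᵥ⟨⟩ m c f =
  ≡.trans (*-distribˡ-Σᵥ m (λ x → if c x then f x else 0)) (Σᵥ-cong (λ x → *-if (c x) m (f x)))

*-distribʳ-Σᵥ⟨⟩ : ∀ {n} m (c : Fin n → Bool) (f : Fin n → ℕ) → Σᵥ⟨ c ⟩ f * m ≡ Σᵥ⟨ c ⟩ (λ x → f x * m)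
*-distribʳ-Σᵥ⟨⟩ m c f =
  ≡.trans (*-distribʳ-Σᵥ m (λ x → if c x then f x else 0)) (Σᵥ-cong (λ x → if-* (c x) (f x) m))

Σᵥ⟨⟩-const : ∀ {n} (c : Fin n → Bool) m → Σᵥ⟨ c ⟩ (λ _ → m) ≡ m * countᵥ c
Σᵥ⟨⟩-const c m = begin
  Σᵥ⟨ c ⟩ (λ _ → m)      ≡⟨ Σᵥ-cong (λ x → if-cong-then (c x) (*-identityʳ m)) ⟨
  Σᵥ⟨ c ⟩ (λ _ → m * 1)  ≡⟨ *-distribˡ-Σᵥ⟨⟩ m c (λ _ → 1) ⟨
  m * countᵥ c           ∎

Σᵥ⟨⟩≡Σᵥ-*-indicator : ∀ {n} (c : Fin n → Bool) (f : Fin n → ℕ) →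
                      Σᵥ⟨ c ⟩ f ≡ Σᵥ (λ x → f x * (if c x then 1 else 0))
Σᵥ⟨⟩≡Σᵥ-*-indicator c f =
  Σᵥ-cong (λ x → ≡.sym (≡.trans (*-if (c x) (f x) 1) (if-cong-then (c x) (*-identityʳ (f x)))))

∸-balance : ∀ a b {p q} → a + p ≡ b + q → a ∸ b + p ≡ b ∸ a + q
∸-balance zero    zero    eq = eq
∸-balance zero    (suc b) eq = eq
∸-balance (suc a) zero    eq = eq
∸-balance (suc a) (suc b) eq = ∸-balance a b (suc-injective eq)

first : ∀ {n} → (Fin n → Bool) → Maybe (Fin n)
first {zero}  p = nothing
first {suc n} p = if p zero then just zero else Maybe.map suc (first (p ∘ suc))

first-sound : ∀ {n} (p : Fin n → Bool) {z} → first p ≡ just z → p z ≡ true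
first-sound {suc n} p eq with p zero in p₀ | first (p ∘ suc) in found
first-sound {suc n} p refl | true  | _      = p₀
first-sound {suc n} p refl | false | just z = first-sound (p ∘ suc) found

first-complete : ∀ {n} (p : Fin n → Bool) {z} → p z ≡ true → first p ≢ nothing
first-complete {suc n} p {z} pz eq with p zero in p₀ | first (p ∘ suc) in found
first-complete {suc n} p {z}     pz () | true  | _
first-complete {suc n} p {z}     pz () | false | just _
first-complete {suc n} p {zero}  pz eq | false | nothing = contradiction (≡.trans (≡.sym p₀) pz) λ ()
first-complete {suc n} p {suc z} pz eq | false | nothing = first-complete (p ∘ suc) pz found

first-cong : ∀ {n} {p q : Fin n → Bool} → p ≗ q → first p ≡ first q
first-cong {zero}  p≗q = refl
first-cong {suc n} p≗q =
  cong₂ (λ b r → if b then just zero else Maybe.map suc r) (p≗q zero) (first-cong (p≗q ∘ suc))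

module Representatives {n} (S : Fin n → Fin n → Bool)
                       (S-isEquivalence : IsEquivalence (λ x y → S x y ≡ true)) where

  open IsEquivalence S-isEquivalence renaming (refl to S-refl; sym to S-sym; trans to S-trans)

  -- The least member of the class of t; the fallback t is never taken, as S t t holds.
  rep : Fin n → Fin n
  rep t = fromMaybe t (first (S t))

  rep-related : ∀ t → S t (rep t) ≡ true
  rep-related t with first (S t) in found
  ... | just _  = first-sound (S t) found
  ... | nothing = S-refl

  S-cong : ∀ {t z} → S t z ≡ true → S t ≗ S z
  S-cong {t} {z} t∼z w with S t w in t∼w | S z w in z∼w
  ... | true  | true  = refl
  ... | false | false = refl
  ... | true  | false = contradiction (≡.trans (≡.sym z∼w) (S-trans (S-sym t∼z) t∼w)) λ ()
  ... | false | true  = contradiction (≡.trans (≡.sym t∼w) (S-trans t∼z z∼w)) λ ()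

  rep-cong : ∀ {t z} → S t z ≡ true → rep t ≡ rep z
  rep-cong {t} {z} t∼z rewrite first-cong (S-cong t∼z) with first (S z) in found
  ... | just _  = refl
  ... | nothing = contradiction found (first-complete (S z) S-refl)

  isRep : Fin n → Bool
  isRep z = ⌊ z ≟ rep z ⌋

  isRep-rep : ∀ t → isRep (rep t) ≡ true
  isRep-rep t =
    ≡.trans (isYes≗does (rep t ≟ rep (rep t))) (dec-true (rep t ≟ rep (rep t)) (rep-cong (rep-related t)))

  isRep∧S≡⌊≟rep⌋ : ∀ t z → (isRep z ∧ S t z) ≡ ⌊ z ≟ rep t ⌋
  isRep∧S≡⌊≟rep⌋ t z with z ≟ rep t
  ... | yes refl = cong₂ _∧_ (isRep-rep t) (rep-related t)
  ... | no z≢rep-t with z ≟ rep z | S t z in t∼z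
  ...   | yes z≡rep-z | true  = contradiction (≡.trans z≡rep-z (≡.sym (rep-cong t∼z))) z≢rep-t
  ...   | yes _       | false = refl
  ...   | no _        | _     = refl

  Σᵥ⟨⟩-by-classes : ∀ (c : Fin n → Bool) (f : Fin n → ℕ) → (∀ {a b} → S a b ≡ true → f a ≡ f b) →
                    Σᵥ⟨ c ⟩ f ≡ Σᵥ⟨ isRep ⟩ (λ z → f z * countᵥ (λ w → c w ∧ S w z))
  Σᵥ⟨⟩-by-classes c f f-cong = begin
    Σᵥ⟨ c ⟩ f
      ≡⟨ Σᵥ-cong (λ w → if-cong-then (c w) (f-via-rep w)) ⟩
    Σᵥ (λ w → if c w then Σᵥ (λ z → if ⌊ z ≟ rep w ⌋ then f z else 0) else 0)
      ≡⟨ Σᵥ-cong (λ w → Σᵥ-if (c w) (λ z → if ⌊ z ≟ rep w ⌋ then f z else 0)) ⟨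
    Σᵥ (λ w → Σᵥ (λ z → if c w then (if ⌊ z ≟ rep w ⌋ then f z else 0) else 0))
      ≡⟨ Σᵥ-comm (λ w z → if c w then (if ⌊ z ≟ rep w ⌋ then f z else 0) else 0) ⟩
    Σᵥ (λ z → Σᵥ (λ w → if c w then (if ⌊ z ≟ rep w ⌋ then f z else 0) else 0))
      ≡⟨ Σᵥ-cong (λ z → Σᵥ-cong (λ w → regroup w z)) ⟩
    Σᵥ (λ z → Σᵥ (λ w → if isRep z then (if c w ∧ S w z then f z else 0) else 0))
      ≡⟨ Σᵥ-cong (λ z → Σᵥ-if (isRep z) (λ w → if c w ∧ S w z then f z else 0)) ⟩
    Σᵥ⟨ isRep ⟩ (λ z → Σᵥ⟨ (λ w → c w ∧ S w z) ⟩ (λ _ → f z))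
      ≡⟨ Σᵥ-cong (λ z → if-cong-then (isRep z) (Σᵥ⟨⟩-const (λ w → c w ∧ S w z) (f z))) ⟩
    Σᵥ⟨ isRep ⟩ (λ z → f z * countᵥ (λ w → c w ∧ S w z))
      ∎
    where
    f-via-rep : ∀ w → f w ≡ Σᵥ (λ z → if ⌊ z ≟ rep w ⌋ then f z else 0)
    f-via-rep w = ≡.trans (f-cong (rep-related w)) (≡.sym (Σᵥ-δ (rep w) f))

    regroup : ∀ w z → (if c w then (if ⌊ z ≟ rep w ⌋ then f z else 0) else 0)
                    ≡ (if isRep z then (if c w ∧ S w z then f z else 0) else 0)
    regroup w z rewrite ≡.sym (isRep∧S≡⌊≟rep⌋ w z) with c w | isRep z
    ... | false | false = refl
    ... | false | true  = refl
    ... | true  | false = refl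
    ... | true  | true  = refl

SameColour : ∀ {n} → Graph n → ℕ → Fin n → Fin n → Set
SameColour G k x y = sameColour G k x y ≡ true

classDegree : ∀ {n} → Graph n → ℕ → Fin n → Fin n → ℕ
classDegree G k x z = countᵥ (λ w → adj G x w ∧ sameColour G k w z)

sameClassDegree : ∀ {n} → Graph n → ℕ → Fin n → Fin n → Fin n → Bool
sameClassDegree G k x y z = classDegree G k x z ≡ᵇ classDegree G k y z

-- allᵥ is the helper defined in the where-block of sameColour, which cannot be referred to by
-- name.  The body of allᵥ is a metavariable solved by unification in allᵥ-solution: its
-- with-abstractions turn all arguments of the helper into distinct variables, so that the
-- unification problem is a Miller pattern.
mutual
  allᵥ : ∀ {n} (G : Graph n) (k : ℕ) (x y : Fin n) {m} → (Fin m → Bool) → Bool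
  allᵥ G k x y = _

  private
    allᵥ-solution : ∀ {m} (G : Graph (suc m)) k x y → sameColour G (suc k) x y ≡
      (sameColour G k x y ∧ (sameClassDegree G k x y zero ∧ allᵥ G k x y (sameClassDegree G k x y ∘ suc)))
    allᵥ-solution {m} G k x y with sameClassDegree G k x y ∘ suc | sameClassDegree G k x y zero
    ... | _ | _ with suc m | G | x | y
    ... | _ | _ | _ | _ = refl

allᵥ-lookup : ∀ {n} (G : Graph n) k x y {m} {p : Fin m → Bool} → allᵥ G k x y p ≡ true → ∀ z → p z ≡ true
allᵥ-lookup G k x y {p = p} all zero    = ∧-conicalˡ (p zero) _ all
allᵥ-lookup G k x y {p = p} all (suc z) = allᵥ-lookup G k x y (∧-conicalʳ (p zero) _ all) z

allᵥ-tabulate : ∀ {n} (G : Graph n) k x y {m} {p : Fin m → Bool} → (∀ z → p z ≡ true) → allᵥ G k x y p ≡ true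
allᵥ-tabulate G k x y {zero}  every = refl
allᵥ-tabulate G k x y {suc m} every = cong₂ _∧_ (every zero) (allᵥ-tabulate G k x y (every ∘ suc))

module _ {n} (G : Graph n) (k : ℕ) {x y : Fin n} where

  sameColour-suc⁻ : SameColour G (suc k) x y →
                    SameColour G k x y × (∀ z → classDegree G k x z ≡ classDegree G k y z)
  sameColour-suc⁻ same =
    ∧-conicalˡ (sameColour G k x y) _ same ,
    λ z → ≡ᵇ⇒≡ _ _ (Equivalence.from T-≡ (allᵥ-lookup G k x y (∧-conicalʳ (sameColour G k x y) _ same) z))

  sameColour-suc⁺ : SameColour G k x y → (∀ z → classDegree G k x z ≡ classDegree G k y z) →
                    SameColour G (suc k) x y
  sameColour-suc⁺ same equal =
    cong₂ _∧_ same (allᵥ-tabulate G k x y (λ z → Equivalence.to T-≡ (≡⇒≡ᵇ _ _ (equal z))))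

sameColour-isEquivalence : ∀ {n} (G : Graph n) k → IsEquivalence (SameColour G k)
sameColour-isEquivalence G zero    = record { refl = refl ; sym = λ _ → refl ; trans = λ _ _ → refl }
sameColour-isEquivalence G (suc k) = record
  { refl  = sameColour-suc⁺ G k refl′ (λ _ → refl)
  ; sym   = λ xy → let (xy₀ , xy-deg) = sameColour-suc⁻ G k xy
                   in sameColour-suc⁺ G k (sym′ xy₀) (≡.sym ∘ xy-deg)
  ; trans = λ xy yz → let (xy₀ , xy-deg) = sameColour-suc⁻ G k xy
                          (yz₀ , yz-deg) = sameColour-suc⁻ G k yz
                      in sameColour-suc⁺ G k (trans′ xy₀ yz₀) (λ z → ≡.trans (xy-deg z) (yz-deg z))
  }
  where open IsEquivalence (sameColour-isEquivalence G k) renaming (refl to refl′; sym to sym′; trans to trans′)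

neighbourSum : ∀ {n} → Graph n → (Fin n → ℕ) → Fin n → ℕ
neighbourSum G f x = Σᵥ⟨ adj G x ⟩ f

walks : ∀ {n} → Graph n → ℕ → Fin n → Fin n → ℕ
walks G zero    u w = if ⌊ w ≟ u ⌋ then 1 else 0
walks G (suc i) u w = neighbourSum G (walks G i u) w

L-balance : ∀ {n} (G : Graph n) i u v w → L G i u v w + walks G i v w ≡ L G i v u w + walks G i u w
L-balance G zero    u v w = +-comm (walks G 0 u w) (walks G 0 v w)
L-balance G (suc i) u v w =
  ∸-balance (ℓ G (suc i) w u v) (ℓ G (suc i) w v u) (Σᵥ⟨⟩-balance (adj G w) (L-balance G i u v))

walkSum : ∀ {n} → Graph n → ℕ → (Fin n → ℕ) → Fin n → ℕ
walkSum G i f u = Σᵥ (λ w → walks G i u w * f w)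

walkSum-zero : ∀ {n} (G : Graph n) f u → walkSum G 0 f u ≡ f u
walkSum-zero G f u = ≡.trans (Σᵥ-cong δ-*) (Σᵥ-δ u f)
  where
  δ-* : ∀ w → walks G 0 u w * f w ≡ (if ⌊ w ≟ u ⌋ then f w else 0)
  δ-* w = ≡.trans (if-* ⌊ w ≟ u ⌋ 1 (f w)) (if-cong-then ⌊ w ≟ u ⌋ (*-identityˡ (f w)))

walkSum-suc : ∀ {n} (G : Graph n) i f u → walkSum G (suc i) f u ≡ walkSum G i (neighbourSum G f) u
walkSum-suc G i f u = begin
  Σᵥ (λ w → Σᵥ⟨ adj G w ⟩ (walks G i u) * f w)
    ≡⟨ Σᵥ-cong (λ w → *-distribʳ-Σᵥ⟨⟩ (f w) (adj G w) (walks G i u)) ⟩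
  Σᵥ (λ w → Σᵥ (λ x → if adj G w x then walks G i u x * f w else 0))
    ≡⟨ Σᵥ-comm (λ w x → if adj G w x then walks G i u x * f w else 0) ⟩
  Σᵥ (λ x → Σᵥ (λ w → if adj G w x then walks G i u x * f w else 0))
    ≡⟨ Σᵥ-cong (λ x → Σᵥ-cong (λ w → if-cong (sym G w x))) ⟩
  Σᵥ (λ x → Σᵥ⟨ adj G x ⟩ (λ w → walks G i u x * f w))
    ≡⟨ Σᵥ-cong (λ x → *-distribˡ-Σᵥ⟨⟩ (walks G i u x) (adj G x) f) ⟨
  Σᵥ (λ x → walks G i u x * neighbourSum G f x)
    ∎

ColourInvariant : ∀ {n} → Graph n → ℕ → (Fin n → ℕ) → Set
ColourInvariant G k f = ∀ {a b} → SameColour G k a b → f a ≡ f b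

module _ {n} (G : Graph n) (k : ℕ) (stable : Stable G k) where

  open Representatives (sameColour G k) (sameColour-isEquivalence G k)

  stable-equitable : ∀ {x y} → SameColour G k x y → ∀ z → classDegree G k x z ≡ classDegree G k y z
  stable-equitable {x} {y} same = proj₂ (sameColour-suc⁻ G k (≡.trans (stable x y) same))

  neighbourSum-invariant : ∀ {f} → ColourInvariant G k f → ColourInvariant G k (neighbourSum G f)
  neighbourSum-invariant {f} f-inv {x} {y} same = begin
    Σᵥ⟨ adj G x ⟩ f
      ≡⟨ Σᵥ⟨⟩-by-classes (adj G x) f f-inv ⟩
    Σᵥ⟨ isRep ⟩ (λ z → f z * classDegree G k x z)
      ≡⟨ Σᵥ-cong (λ z → if-cong-then (isRep z) (cong (f z *_) (stable-equitable same z))) ⟩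
    Σᵥ⟨ isRep ⟩ (λ z → f z * classDegree G k y z)
      ≡⟨ Σᵥ⟨⟩-by-classes (adj G y) f f-inv ⟨
    Σᵥ⟨ adj G y ⟩ f
      ∎

  degree-invariant : ColourInvariant G k (degree G)
  degree-invariant = neighbourSum-invariant (λ _ → refl)

  walkSum-invariant : ∀ i {f} → ColourInvariant G k f → ColourInvariant G k (walkSum G i f)
  walkSum-invariant zero {f} f-inv {a} {b} same = begin
    walkSum G 0 f a  ≡⟨ walkSum-zero G f a ⟩
    f a              ≡⟨ f-inv same ⟩
    f b              ≡⟨ walkSum-zero G f b ⟨
    walkSum G 0 f b  ∎
  walkSum-invariant (suc i) {f} f-inv {a} {b} same = begin
    walkSum G (suc i) f a             ≡⟨ walkSum-suc G i f a ⟩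
    walkSum G i (neighbourSum G f) a  ≡⟨ walkSum-invariant i (neighbourSum-invariant f-inv) same ⟩
    walkSum G i (neighbourSum G f) b  ≡⟨ walkSum-suc G i f b ⟨
    walkSum G (suc i) f b             ∎

  Σᵥ⟨⟩-walks-invariant : ∀ i {c : Fin n → Bool} → (∀ {a b} → SameColour G k a b → c a ≡ c b) →
                         ColourInvariant G k (λ u → Σᵥ⟨ c ⟩ (walks G i u))
  Σᵥ⟨⟩-walks-invariant i {c} c-inv {a} {b} same = begin
    Σᵥ⟨ c ⟩ (walks G i a)    ≡⟨ Σᵥ⟨⟩≡Σᵥ-*-indicator c (walks G i a) ⟩
    walkSum G i indicator a  ≡⟨ walkSum-invariant i (if-cong ∘ c-inv) same ⟩
    walkSum G i indicator b  ≡⟨ Σᵥ⟨⟩≡Σᵥ-*-indicator c (walks G i b) ⟨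
    Σᵥ⟨ c ⟩ (walks G i b)    ∎
    where
    indicator : Fin n → ℕ
    indicator w = if c w then 1 else 0

  degCount-sym : ∀ {u v} → SameColour G k u v → ∀ i d → degCount G i d u v ≡ degCount G i d v u
  degCount-sym {u} {v} same i d = +-cancelʳ-≡ (Σᵥ⟨ hasDegree ⟩ (walks G i v)) _ _ (begin
    degCount G i d u v + Σᵥ⟨ hasDegree ⟩ (walks G i v)
      ≡⟨ Σᵥ⟨⟩-balance hasDegree (L-balance G i u v) ⟩
    degCount G i d v u + Σᵥ⟨ hasDegree ⟩ (walks G i u)
      ≡⟨ cong (degCount G i d v u +_) (Σᵥ⟨⟩-walks-invariant i has-degree-invariant same) ⟩
    degCount G i d v u + Σᵥ⟨ hasDegree ⟩ (walks G i v)
      ∎)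
    where
    hasDegree : Fin n → Bool
    hasDegree w = degree G w ≡ᵇ d

    has-degree-invariant : ∀ {a b} → SameColour G k a b → hasDegree a ≡ hasDegree b
    has-degree-invariant = cong (_≡ᵇ d) ∘ degree-invariant

lemma3p5 : ∀ {n} (G : Graph n) (u v : Fin n) → u ≢ v →
    Σ ℕ (λ i → Σ ℕ (λ d → 1 ≤ i × 1 ≤ d × degCount G i d u v ≢ degCount G i d v u)) →
    ∀ k → StabilisesAt G k → sameColour G k u v ≡ false
lemma3p5 G u v _ (i , d , _ , _ , counts-differ) k (stable , _) with sameColour G k u v in same
... | false = refl
... | true  = contradiction (degCount-sym G k stable same i d) counts-differ
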